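{- Let $q$ be a prime power, let $k,m$ be positive integers, let $\mathbb{V}(k,q^m)$ be a $k$-dimensional $\mathbb{F}_{q^m}$-vector space and let $U$ be an $\mathbb{F}_q$-subspace of $\mathbb{V}(k,q^m)$ with $\dim_{\mathbb{F}_q}(U)=n$ and $\langle U\rangle_{\mathbb{F}_{q^m}}=\mathbb{V}(k,q^m)$. Let $t_s=\min\{\dim_{\mathbb{F}_{q^m}}(T): T \text{ an } \mathbb{F}_{q^m}\text{ -subspace of } \mathbb{V}(k,q^m) \text{ with } \varepsilon_U(T)=n-k\}$. Then $t_s<k$ if and only if there exists an $\mathbb{F}_{q^m}$-hyperplane $H$ of $\mathbb{V}(k,q^m)$ such that $w_U(H)=n-1$.
   Context: $\mathbb{V}(k,q^m)$ is regarded also as an $\mathbb{F}_q$-vector space. For an $\mathbb{F}_q$-subspace $U$ and an $\mathbb{F}_{q^m}$-subspace $T$ of $\mathbb{V}(k,q^m)$, the weight of $T$ with respect to $U$ is $w_U(T)=\dim_{\mathbb{F}_q}(U\cap T)$ and the defect of $T$ with respect to $U$ is $\varepsilon_U(T)=w_U(T)-\dim_{\mathbb{F}_{q^m}}(T)$. (Note $\varepsilon_U(\mathbb{V}(k,q^m))=n-k$ and $n-k$ is the largest possible defect.) -}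

module Defs where

open import Level using (Level; _⊔_) renaming (suc to lsuc)
open import Algebra.Bundles using (CommutativeRing)
import Data.Nat
open import Data.Nat using (ℕ; _^_; _≤_) renaming (suc to sucℕ)
open import Data.Nat.Primality using (Prime)
open import Data.Fin using (Fin; zero; suc)
open import Data.Product using (Σ; ∃; _×_; _,_)
open import Relation.Nullary using (¬_)
open import Relation.Binary.PropositionalEquality using (_≡_)

IsPrimePower : ℕ → Set
IsPrimePower q = Σ ℕ λ p → Σ ℕ λ e → Prime p × (1 ≤ e) × (q ≡ p ^ e)

module FieldTheory {c ℓ : Level} (R : CommutativeRing c ℓ) where
  open CommutativeRing R hiding (zero)

  IsField : Set (c ⊔ ℓ)
  IsField = (¬ (1# ≈ 0#)) × (∀ x → ¬ (x ≈ 0#) → ∃ λ y → (x * y) ≈ 1#)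

  HasSize : (Carrier → Set (c ⊔ ℓ)) → ℕ → Set (c ⊔ ℓ)
  HasSize P N = Σ (Fin N → Carrier) λ f →
      (∀ i → P (f i))
    × (∀ i j → f i ≈ f j → i ≡ j)
    × (∀ x → P x → ∃ λ i → x ≈ f i)

  IsSubfield : (Carrier → Set (c ⊔ ℓ)) → Set (c ⊔ ℓ)
  IsSubfield K =
      (∀ {x y} → x ≈ y → K x → K y)
    × K 0# × K 1#
    × (∀ {x y} → K x → K y → K (x + y))
    × (∀ {x} → K x → K (- x))
    × (∀ {x y} → K x → K y → K (x * y))
    × (∀ {x} → K x → ¬ (x ≈ 0#) → Σ Carrier λ y → K y × ((x * y) ≈ 1#))

  All : Carrier → Set (c ⊔ ℓ)
  All _ = Level.Lift (c ⊔ ℓ) Data.Unit.⊤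
    where import Data.Unit

  V : ℕ → Set c
  V k = Fin k → Carrier

  module _ {k : ℕ} where
    _≈ᵥ_ : V k → V k → Set ℓ
    u ≈ᵥ v = ∀ i → u i ≈ v i

    0ᵥ : V k
    0ᵥ _ = 0#

    _+ᵥ_ : V k → V k → V k
    (u +ᵥ v) i = u i + v i

    _·_ : Carrier → V k → V k
    (a · v) i = a * v i

    lincomb : (d : ℕ) → (Fin d → Carrier) → (Fin d → V k) → V k
    lincomb ℕ.zero    cs bs = 0ᵥ
    lincomb (sucℕ d) cs bs = (cs zero · bs zero) +ᵥ lincomb d (λ i → cs (suc i)) (λ i → bs (suc i))

    Subset : Set (lsuc (c ⊔ ℓ))
    Subset = V k → Set (c ⊔ ℓ)

    _∩_ : Subset → Subset → Subset
    (S ∩ T) v = S v × T v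

    IsSubspace : (Carrier → Set (c ⊔ ℓ)) → Subset → Set (c ⊔ ℓ)
    IsSubspace P S =
        (∀ {u v} → u ≈ᵥ v → S u → S v)
      × S 0ᵥ
      × (∀ {u v} → S u → S v → S (u +ᵥ v))
      × (∀ {a v} → P a → S v → S (a · v))

    HasDim : (Carrier → Set (c ⊔ ℓ)) → Subset → ℕ → Set (c ⊔ ℓ)
    HasDim P S d = Σ (Fin d → V k) λ b →
        (∀ i → S (b i))
      × (∀ cs → (∀ i → P (cs i)) → lincomb d cs b ≈ᵥ 0ᵥ → ∀ i → cs i ≈ 0#)
      × (∀ v → S v → Σ (Fin d → Carrier) λ cs → (∀ i → P (cs i)) × (v ≈ᵥ lincomb d cs b))

    SpansAll : Subset → Set (c ⊔ ℓ)
    SpansAll U = ∀ v → Σ ℕ λ r → Σ (Fin r → V k) λ us → Σ (Fin r → Carrier) λ cs →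
      (∀ i → U (us i)) × (v ≈ᵥ lincomb r cs us)

    -- T is an R-subspace with dim_R T = t and w_U(T) = dim_K(U ∩ T) = w
    -- the defect ε_U(T) = w - t equals n - k  (stated as w + k ≡ n + t, avoiding truncated subtraction)
    HasMaxDefect : (K : Carrier → Set (c ⊔ ℓ)) → (U : Subset) → (n : ℕ) → Subset → ℕ → Set (c ⊔ ℓ)
    HasMaxDefect K U n T t = IsSubspace All T × HasDim All T t ×
      (Σ ℕ λ w → HasDim K (U ∩ T) w × (w Data.Nat.+ k ≡ n Data.Nat.+ t))

    IsTs : (K : Carrier → Set (c ⊔ ℓ)) → (U : Subset) → (n : ℕ) → ℕ → Set (lsuc (c ⊔ ℓ))
    IsTs K U n t = (Σ Subset λ T → HasMaxDefect K U n T t)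
      × (∀ T t' → HasMaxDefect K U n T t' → t ≤ t')

{-# OPTIONS --safe #-}
module Submission where

-- Let T realise t_s, with basis τ, so that dim_K (U ∩ T) = n − k + t_s. Extend τ by vectors
-- z₀, …, z_{r−1} of U to a basis of V; if t_s < k then r ≥ 1. Dropping z₀ gives a hyperplane H,
-- spanned by T and r − 1 vectors of U, so U ∩ H contains the K-independent family z₁, …, z_{r−1}
-- together with a K-basis of U ∩ T, i.e. n − 1 vectors. It contains no more: since z₀ ∈ U ∖ H,
-- any further independent vector would give n + 1 independent vectors of U. Conversely, a
-- hyperplane of weight n − 1 has defect n − k, so t_s ≤ k − 1. Finiteness of the fields makes
-- membership in a span decidable, which is what the exchange lemma and basis extension need.

open import Defs
open import Level using (Level; _⊔_; lift)
open import Algebra.Bundles using (CommutativeRing)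
open import Data.Nat as ℕ using (ℕ; zero; suc; _^_; _≤_; _<_; _∸_; z≤n; s≤s)
open import Data.Nat.Properties as ℕₚ using (+-suc; +-cancelʳ-≡; ≤-antisym; ≤-trans; m≤n⇒m≤1+n; 1+n≰n; <⇒≢)
open import Data.Fin as Fin using (Fin; zero; suc; splitAt; punchIn)
open import Data.Fin.Properties using (any?; all?; join-splitAt)
open import Data.Sum.Properties using ([,]-map; [,]-∘)
open import Data.Product using (Σ; ∃; _×_; _,_; proj₁; proj₂)
open import Data.Vec.Functional using (Vector; _∷_; _++_; head; tail; insertAt; removeAt; take; drop)
open import Data.Vec.Functional.Properties using (∷-cong; insertAt-punchIn; lookup-++ˡ; lookup-++ʳ)
open import Data.Vec.Functional.Relation.Unary.All.Properties using (++⁺; ++⁻ˡ)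
open import Data.Empty using (⊥-elim)
open import Function using (_∘_)
open import Function.Bundles using (_⇔_; mk⇔)
open import Relation.Nullary using (¬_; Dec; yes; no; ¬?)
open import Relation.Nullary.Decidable using (map′; decidable-stable)
open import Relation.Binary.Definitions using (Decidable)
import Relation.Binary.PropositionalEquality as ≡
open ≡ using (_≡_; _≗_)

private
  variable
    a p : Level
    A : Set a
    m n : ℕ

++-tail : (xs : Vector A (suc m)) (ys : Vector A n) → tail (xs ++ ys) ≗ tail xs ++ ys
++-tail {m = m} xs ys i = [,]-map (splitAt m i)

∷-++ : ∀ x (xs : Vector A m) (ys : Vector A n) → (x ∷ xs) ++ ys ≗ x ∷ (xs ++ ys)
∷-++ x xs ys = ∷-cong ≡.refl (++-tail (x ∷ xs) ys)

take-++-drop : ∀ m (xs : Vector A (m ℕ.+ n)) → take m xs ++ drop m xs ≗ xs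
take-++-drop {n = n} m xs i = ≡.trans (≡.sym ([,]-∘ xs (splitAt m i))) (≡.cong xs (join-splitAt m n i))

∷⁺ : {P : A → Set p} {x : A} {xs : Vector A n} → P x → (∀ i → P (xs i)) → ∀ i → P ((x ∷ xs) i)
∷⁺ px pxs zero    = px
∷⁺ px pxs (suc i) = pxs i

insertAt⁺ : {P : A → Set p} (xs : Vector A n) (i : Fin (suc n)) {x : A} →
            P x → (∀ j → P (xs j)) → ∀ j → P (insertAt xs i x j)
insertAt⁺                     xs zero    px pxs zero    = px
insertAt⁺                     xs zero    px pxs (suc j) = pxs j
insertAt⁺ {n = suc n}         xs (suc i) px pxs zero    = pxs zero
insertAt⁺ {n = suc n} {P = P} xs (suc i) px pxs (suc j) = insertAt⁺ {P = P} (tail xs) i px (pxs ∘ suc) j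

pred-+-suc : 1 ≤ m → (m ∸ 1) ℕ.+ suc n ≡ m ℕ.+ n
pred-+-suc {suc m} {n} _ = +-suc m n

count-cancel : ∀ {n t w k} r → w ℕ.+ k ≡ n ℕ.+ t → r ℕ.+ t ≡ k → n ≡ r ℕ.+ w
count-cancel {n} {t} {w} {k} r w+k≡n+t r+t≡k = +-cancelʳ-≡ t n (r ℕ.+ w) (begin
  n ℕ.+ t              ≡⟨ ≡.sym w+k≡n+t ⟩
  w ℕ.+ k              ≡⟨ ≡.cong (w ℕ.+_) (≡.sym r+t≡k) ⟩
  w ℕ.+ (r ℕ.+ t)      ≡⟨ ≡.sym (ℕₚ.+-assoc w r t) ⟩
  (w ℕ.+ r) ℕ.+ t      ≡⟨ ≡.cong (ℕ._+ t) (ℕₚ.+-comm w r) ⟩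
  (r ℕ.+ w) ℕ.+ t      ∎)
  where open ≡.≡-Reasoning

module LinearAlgebra {c ℓ : Level} (L : CommutativeRing c ℓ) where

  open CommutativeRing L renaming (Carrier to F) hiding (zero)
  open FieldTheory L
  open import Algebra.Properties.Ring ring
    using (-‿distribˡ-*; -‿distribʳ-*; -1*x≈-x; +-inverseˡ-unique; -‿injective; -0#≈0#)
  open import Algebra.Properties.Group +-group using (\\-leftDividesˡ; \\-leftDividesʳ)
  open import Algebra.Properties.CommutativeSemigroup +-commutativeSemigroup using (interchange; x∙yz≈y∙xz)
  open import Algebra.Properties.Semiring.Sum semiring using (sum)
  open import Data.Vec.Functional.Relation.Binary.Equality.Setoid setoid using (≋-refl; ≋-sym; ≋-trans; ≋-reflexive)
  open import Relation.Binary.Reasoning.Setoid setoid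

  Scalars : Set (Level.suc (c ⊔ ℓ))
  Scalars = F → Set (c ⊔ ℓ)

  module _ {k : ℕ} where

    lincomb-cong : ∀ d {cs ds : Fin d → F} {x y : Fin d → V k} →
                   (∀ i → cs i ≈ ds i) → (∀ i → x i ≈ᵥ y i) → lincomb d cs x ≈ᵥ lincomb d ds y
    lincomb-cong zero    cs≈ds x≈y j = refl
    lincomb-cong (suc d) cs≈ds x≈y j =
      +-cong (*-cong (cs≈ds zero) (x≈y zero j)) (lincomb-cong d (cs≈ds ∘ suc) (x≈y ∘ suc) j)

    lincomb-zeroˡ : ∀ d {cs : Fin d → F} (x : Fin d → V k) → (∀ i → cs i ≈ 0#) → lincomb d cs x ≈ᵥ 0ᵥ
    lincomb-zeroˡ zero    x cs≈0 j = refl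
    lincomb-zeroˡ (suc d) x cs≈0 j =
      trans (+-cong (trans (*-congʳ (cs≈0 zero)) (zeroˡ _)) (lincomb-zeroˡ d (tail x) (cs≈0 ∘ suc) j)) (+-identityˡ 0#)

    lincomb-zeroʳ : ∀ d (cs : Fin d → F) → lincomb d cs (λ _ → 0ᵥ {k}) ≈ᵥ 0ᵥ
    lincomb-zeroʳ zero    cs j = refl
    lincomb-zeroʳ (suc d) cs j = trans (+-cong (zeroʳ _) (lincomb-zeroʳ d (tail cs) j)) (+-identityʳ 0#)

    lincomb-+ : ∀ d (cs ds : Fin d → F) (x : Fin d → V k) →
                lincomb d (λ i → cs i + ds i) x ≈ᵥ (lincomb d cs x +ᵥ lincomb d ds x)
    lincomb-+ zero    cs ds x j = sym (+-identityˡ 0#)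
    lincomb-+ (suc d) cs ds x j = begin
      (cs zero + ds zero) * x zero j + lincomb d _ (tail x) j
        ≈⟨ +-cong (distribʳ _ _ _) (lincomb-+ d (tail cs) (tail ds) (tail x) j) ⟩
      (cs zero * x zero j + ds zero * x zero j) + (lincomb d (tail cs) (tail x) j + lincomb d (tail ds) (tail x) j)
        ≈⟨ interchange _ _ _ _ ⟩
      _ ∎

    lincomb-* : ∀ d s (cs : Fin d → F) (x : Fin d → V k) → lincomb d (λ i → s * cs i) x ≈ᵥ (s · lincomb d cs x)
    lincomb-* zero    s cs x j = sym (zeroʳ s)
    lincomb-* (suc d) s cs x j = begin
      (s * cs zero) * x zero j + lincomb d _ (tail x) j
        ≈⟨ +-cong (*-assoc _ _ _) (lincomb-* d s (tail cs) (tail x) j) ⟩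
      s * (cs zero * x zero j) + s * lincomb d (tail cs) (tail x) j
        ≈⟨ sym (distribˡ _ _ _) ⟩
      _ ∎

    lincomb-+ᵥ : ∀ d (cs : Fin d → F) (x y : Fin d → V k) →
                 lincomb d cs (λ i → (x i +ᵥ y i)) ≈ᵥ (lincomb d cs x +ᵥ lincomb d cs y)
    lincomb-+ᵥ zero    cs x y j = sym (+-identityˡ 0#)
    lincomb-+ᵥ (suc d) cs x y j = begin
      cs zero * (x zero j + y zero j) + lincomb d (tail cs) _ j
        ≈⟨ +-cong (distribˡ _ _ _) (lincomb-+ᵥ d (tail cs) (tail x) (tail y) j) ⟩
      (cs zero * x zero j + cs zero * y zero j) + (lincomb d (tail cs) (tail x) j + lincomb d (tail cs) (tail y) j)
        ≈⟨ interchange _ _ _ _ ⟩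
      _ ∎

    lincomb-· : ∀ d (cs s : Fin d → F) (w : V k) →
                lincomb d cs (λ i → s i · w) ≈ᵥ (sum (λ i → cs i * s i) · w)
    lincomb-· zero    cs s w j = sym (zeroˡ (w j))
    lincomb-· (suc d) cs s w j = begin
      cs zero * (s zero * w j) + lincomb d (tail cs) _ j
        ≈⟨ +-cong (sym (*-assoc _ _ _)) (lincomb-· d (tail cs) (tail s) w j) ⟩
      (cs zero * s zero) * w j + sum (λ i → cs (suc i) * s (suc i)) * w j
        ≈⟨ sym (distribʳ _ _ _) ⟩
      _ ∎

    lincomb-insertAt : ∀ d (cs : Fin d → F) (i : Fin (suc d)) σ (x : Fin (suc d) → V k) →
                       lincomb (suc d) (insertAt cs i σ) x ≈ᵥ ((σ · x i) +ᵥ lincomb d cs (removeAt x i))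
    lincomb-insertAt d       cs zero    σ x = ≋-refl
    lincomb-insertAt (suc d) cs (suc i) σ x j =
      trans (+-congˡ (lincomb-insertAt d (tail cs) i σ (tail x) j)) (x∙yz≈y∙xz _ _ _)

    lincomb-++ : ∀ d {e} (cs : Fin d → F) (ds : Fin e → F) (x : Fin d → V k) (y : Fin e → V k) →
                 lincomb (d ℕ.+ e) (cs ++ ds) (x ++ y) ≈ᵥ (lincomb d cs x +ᵥ lincomb e ds y)
    lincomb-++ zero    cs ds x y j = sym (+-identityˡ _)
    lincomb-++ (suc d) {e} cs ds x y j = begin
      cs zero * x zero j + lincomb (d ℕ.+ e) (tail (cs ++ ds)) (tail (x ++ y)) j
        ≈⟨ +-congˡ (lincomb-cong (d ℕ.+ e) (reflexive ∘ ++-tail cs ds) (≋-reflexive ∘ ++-tail x y) j) ⟩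
      cs zero * x zero j + lincomb (d ℕ.+ e) (tail cs ++ ds) (tail x ++ y) j
        ≈⟨ +-congˡ (lincomb-++ d (tail cs) ds (tail x) y j) ⟩
      cs zero * x zero j + (lincomb d (tail cs) (tail x) j + lincomb e ds y j)
        ≈⟨ sym (+-assoc _ _ _) ⟩
      _ ∎

    lincomb-head-zero : ∀ d (cs : Fin (suc d) → F) (x : Fin (suc d) → V k) →
                        cs zero ≈ 0# → lincomb (suc d) cs x ≈ᵥ lincomb d (tail cs) (tail x)
    lincomb-head-zero d cs x c₀≈0 j =
      trans (+-congʳ (trans (*-congʳ c₀≈0) (zeroˡ _))) (+-identityˡ _)

  lincomb-pointwise : ∀ {k k′} d (cs : Fin d → F) (x : Fin d → V k) (y : Fin d → V k′) j j′ →
                      (∀ i → x i j ≈ y i j′) → lincomb d cs x j ≈ lincomb d cs y j′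
  lincomb-pointwise zero    cs x y j j′ x≈y = refl
  lincomb-pointwise (suc d) cs x y j j′ x≈y =
    +-cong (*-congˡ (x≈y zero)) (lincomb-pointwise d (tail cs) (tail x) (tail y) j j′ (x≈y ∘ suc))

  unit : ∀ {k} → Fin k → V k
  unit zero    zero    = 1#
  unit zero    (suc j) = 0#
  unit (suc i) zero    = 0#
  unit (suc i) (suc j) = unit i j

  lincomb-unit : ∀ k (v : V k) → lincomb k v unit ≈ᵥ v
  lincomb-unit (suc k) v zero = begin
    v zero * 1# + lincomb k (tail v) (tail unit) zero
      ≈⟨ +-cong (*-identityʳ _)
                (lincomb-pointwise k (tail v) (tail unit) (λ _ → 0ᵥ {suc k}) zero zero (λ _ → refl)) ⟩
    v zero + lincomb k (tail v) (λ _ → 0ᵥ {suc k}) zero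
      ≈⟨ +-congˡ (lincomb-zeroʳ k (tail v) zero) ⟩
    v zero + 0#
      ≈⟨ +-identityʳ _ ⟩
    v zero ∎
  lincomb-unit (suc k) v (suc j) = begin
    v zero * 0# + lincomb k (tail v) (tail unit) (suc j)
      ≈⟨ +-cong (zeroʳ _) (lincomb-pointwise k (tail v) (tail unit) unit (suc j) j (λ _ → refl)) ⟩
    0# + lincomb k (tail v) unit j
      ≈⟨ +-identityˡ _ ⟩
    lincomb k (tail v) unit j
      ≈⟨ lincomb-unit k (tail v) j ⟩
    v (suc j) ∎

  module _ {k : ℕ} where

    Span : Scalars → (d : ℕ) → (Fin d → V k) → Subset {k}
    Span P d x v = Σ (Fin d → F) λ cs → (∀ i → P (cs i)) × (v ≈ᵥ lincomb d cs x)

    Independent : Scalars → (d : ℕ) → (Fin d → V k) → Set (c ⊔ ℓ)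
    Independent P d x = ∀ cs → (∀ i → P (cs i)) → lincomb d cs x ≈ᵥ 0ᵥ → ∀ i → cs i ≈ 0#

    IsHyperplaneOfWeight : Scalars → Subset {k} → ℕ → Subset {k} → Set (c ⊔ ℓ)
    IsHyperplaneOfWeight K U w H = IsSubspace All H × HasDim All H (k ∸ 1) × HasDim K (U ∩ H) w

    span-resp : ∀ {P d x u v} → u ≈ᵥ v → Span P d x u → Span P d x v
    span-resp u≈v (cs , cs∈P , u≈) = cs , cs∈P , ≋-trans (≋-sym u≈v) u≈

    span-resp-≗ : ∀ {P d x y v} → x ≗ y → Span P d x v → Span P d y v
    span-resp-≗ {d = d} x≗y (cs , cs∈P , v≈) =
      cs , cs∈P , ≋-trans v≈ (lincomb-cong d (λ _ → refl) (≋-reflexive ∘ x≗y))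

    span-weaken : ∀ {P d x v} → Span P d x v → Span All d x v
    span-weaken (cs , _ , v≈) = cs , (λ _ → lift _) , v≈

    independent-resp-≗ : ∀ {P d x y} → x ≗ y → Independent P d x → Independent P d y
    independent-resp-≗ {d = d} x≗y x-indep cs cs∈P comb≈0 =
      x-indep cs cs∈P (≋-trans (lincomb-cong d (λ _ → refl) (≋-reflexive ∘ x≗y)) comb≈0)

  finite⇒decidable : ∀ {N} → HasSize All N → Decidable _≈_
  finite⇒decidable (f , _ , f-injective , f-onto) x y with f-onto x (lift _) | f-onto y (lift _)
  ... | i , x≈fi | j , y≈fj =
    map′ (λ i≡j → trans x≈fi (trans (reflexive (≡.cong f i≡j)) (sym y≈fj)))
         (λ x≈y → f-injective i j (trans (sym x≈fi) (trans x≈y y≈fj)))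
         (i Fin.≟ j)

  module Subfield {P : Scalars} (P-subfield : IsSubfield P) where

    P-0 : P 0#
    P-0 = proj₁ (proj₂ P-subfield)

    P-1 : P 1#
    P-1 = proj₁ (proj₂ (proj₂ P-subfield))

    P-+ : ∀ {x y} → P x → P y → P (x + y)
    P-+ = proj₁ (proj₂ (proj₂ (proj₂ P-subfield)))

    P-neg : ∀ {x} → P x → P (- x)
    P-neg = proj₁ (proj₂ (proj₂ (proj₂ (proj₂ P-subfield))))

    P-* : ∀ {x y} → P x → P y → P (x * y)
    P-* = proj₁ (proj₂ (proj₂ (proj₂ (proj₂ (proj₂ P-subfield)))))

    P-inv : ∀ {x} → P x → ¬ (x ≈ 0#) → Σ F λ y → P y × (x * y ≈ 1#)
    P-inv = proj₂ (proj₂ (proj₂ (proj₂ (proj₂ (proj₂ P-subfield)))))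

    sum-closed : ∀ {d} (xs : Fin d → F) → (∀ i → P (xs i)) → P (sum xs)
    sum-closed {zero}  xs xs∈P = P-0
    sum-closed {suc d} xs xs∈P = P-+ (xs∈P zero) (sum-closed (tail xs) (xs∈P ∘ suc))

    module _ {k : ℕ} where

      lincomb-closed : ∀ {S : Subset {k}} → IsSubspace P S → ∀ d {cs : Fin d → F} {x : Fin d → V k} →
                       (∀ i → P (cs i)) → (∀ i → S (x i)) → S (lincomb d cs x)
      lincomb-closed (_ , S-0 , _ , _) zero _ _ = S-0
      lincomb-closed S-subspace@(_ , _ , S-+ , S-·) (suc d) cs∈P x∈S =
        S-+ (S-· (cs∈P zero) (x∈S zero)) (lincomb-closed S-subspace d (cs∈P ∘ suc) (x∈S ∘ suc))

      span-minimal : ∀ {S : Subset {k}} {d} {x : Fin d → V k} {v} →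
                     IsSubspace P S → (∀ i → S (x i)) → Span P d x v → S v
      span-minimal {d = d} S-subspace@(S-resp , _) x∈S (cs , cs∈P , v≈) =
        S-resp (≋-sym v≈) (lincomb-closed S-subspace d cs∈P x∈S)

      span-0 : ∀ {d} {x : Fin d → V k} → Span P d x 0ᵥ
      span-0 {d} {x} = (λ _ → 0#) , (λ _ → P-0) , ≋-sym (lincomb-zeroˡ d x (λ _ → refl))

      span-isSubspace : ∀ {d} {x : Fin d → V k} → IsSubspace P (Span P d x)
      span-isSubspace {d} {x} = span-resp {P = P} , span-0 , span-+ , span-·
        where
        span-+ : ∀ {u v} → Span P d x u → Span P d x v → Span P d x (u +ᵥ v)
        span-+ (cs , cs∈P , u≈) (ds , ds∈P , v≈) =
          (λ i → cs i + ds i) , (λ i → P-+ (cs∈P i) (ds∈P i)) ,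
          ≋-trans (λ j → +-cong (u≈ j) (v≈ j)) (≋-sym (lincomb-+ d cs ds x))
        span-· : ∀ {s v} → P s → Span P d x v → Span P d x (s · v)
        span-· {s} s∈P (cs , cs∈P , v≈) =
          (λ i → s * cs i) , (λ i → P-* s∈P (cs∈P i)) ,
          ≋-trans (λ j → *-congˡ (v≈ j)) (≋-sym (lincomb-* d s cs x))

      span-trans : ∀ {d e} {x : Fin d → V k} {y : Fin e → V k} {v} →
                   (∀ i → Span P e y (x i)) → Span P d x v → Span P e y v
      span-trans = span-minimal span-isSubspace

      span-member : ∀ {d} (x : Fin d → V k) i → Span P d x (x i)
      span-member {suc d} x i =
        insertAt (λ _ → 0#) i 1# , insertAt⁺ {P = P} (λ _ → 0#) i P-1 (λ _ → P-0) , λ j → sym (begin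
          lincomb (suc d) (insertAt (λ _ → 0#) i 1#) x j     ≈⟨ lincomb-insertAt d _ i 1# x j ⟩
          1# * x i j + lincomb d (λ _ → 0#) (removeAt x i) j
            ≈⟨ +-cong (*-identityˡ _) (lincomb-zeroˡ d _ (λ _ → refl) j) ⟩
          x i j + 0#                                         ≈⟨ +-identityʳ _ ⟩
          x i j                                              ∎)

      span-∷ : ∀ {d} {x : Fin d → V k} {v} w → Span P d x v → Span P (suc d) (w ∷ x) v
      span-∷ {x = x} w = span-trans {y = w ∷ x} (λ i → span-member (w ∷ x) (suc i))

      independent-tail : ∀ {d} {x : Fin (suc d) → V k} → Independent P (suc d) x → Independent P d (tail x)
      independent-tail {d} {x} x-indep cs cs∈P comb≈0 i =
        x-indep (0# ∷ cs) (∷⁺ {P = P} P-0 cs∈P) (≋-trans (lincomb-head-zero d (0# ∷ cs) x refl) comb≈0) (suc i)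

  module FiniteField (isField : IsField) {N} (L-finite : HasSize All N) where

    _≟_ : Decidable _≈_
    _≟_ = finite⇒decidable L-finite

    All-subfield : IsSubfield All
    All-subfield = (λ _ _ → lift _) , lift _ , lift _ , (λ _ _ → lift _) , (λ _ → lift _) , (λ _ _ → lift _) ,
                   λ _ x≉0 → let y , xy≈1 = proj₂ isField _ x≉0 in y , lift _ , xy≈1

    -- Recursion on d, trying each of the finitely many admissible values of the first coefficient.
    span? : ∀ {P : Scalars} {M} → HasSize P M → ∀ {k} d (x : Fin d → V k) v → Dec (Span P d x v)
    span? P-finite zero x v =
      map′ (λ v≈0 → (λ ()) , (λ ()) , v≈0) (λ (_ , _ , v≈0) → v≈0) (all? λ j → v j ≟ 0#)
    span? {P} P-finite@(f , f∈P , _ , f-onto) (suc d) x v =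
      map′ from to (any? λ i → span? P-finite d (tail x) (λ j → - (f i * x zero j) + v j))
      where
      from : (∃ λ i → Span P d (tail x) (λ j → - (f i * x zero j) + v j)) → Span P (suc d) x v
      from (i , cs , cs∈P , eq) =
        f i ∷ cs , ∷⁺ {P = P} (f∈P i) cs∈P , λ j → trans (sym (\\-leftDividesˡ _ _)) (+-congˡ (eq j))
      to : Span P (suc d) x v → ∃ λ i → Span P d (tail x) (λ j → - (f i * x zero j) + v j)
      to (cs , cs∈P , eq) with f-onto (cs zero) (cs∈P zero)
      ... | i , c₀≈fi = i , tail cs , cs∈P ∘ suc , λ j → begin
        - (f i * x zero j) + v j
          ≈⟨ +-cong (-‿cong (*-congʳ (sym c₀≈fi))) (eq j) ⟩
        - (cs zero * x zero j) + (cs zero * x zero j + lincomb d (tail cs) (tail x) j)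
          ≈⟨ \\-leftDividesʳ _ _ ⟩
        lincomb d (tail cs) (tail x) j ∎

    module Exchange {P : Scalars} (P-subfield : IsSubfield P) where

      open Subfield P-subfield public

      module _ {k : ℕ} where

        independent-∷ : ∀ {d} {x : Fin d → V k} {v} → Independent P d x → ¬ Span P d x v →
                        Independent P (suc d) (v ∷ x)
        independent-∷ {d} {x} {v} x-indep v∉ cs cs∈P comb≈0 with cs zero ≟ 0#
        ... | yes c₀≈0 = λ where
          zero    → c₀≈0
          (suc i) → x-indep (tail cs) (cs∈P ∘ suc) (≋-trans (≋-sym (lincomb-head-zero d cs (v ∷ x) c₀≈0)) comb≈0) i
        ... | no c₀≉0 with P-inv (cs∈P zero) c₀≉0
        ...   | c⁻¹ , c⁻¹∈P , c₀c⁻¹≈1 =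
          ⊥-elim (v∉ ((λ i → - c⁻¹ * cs (suc i)) , (λ i → P-* (P-neg c⁻¹∈P) (cs∈P (suc i))) , v≈))
          where
          v≈ : v ≈ᵥ lincomb d (λ i → - c⁻¹ * cs (suc i)) x
          v≈ j = begin
            v j                                  ≈⟨ sym (*-identityˡ _) ⟩
            1# * v j                             ≈⟨ *-congʳ (trans (sym c₀c⁻¹≈1) (*-comm _ _)) ⟩
            (c⁻¹ * cs zero) * v j                ≈⟨ *-assoc _ _ _ ⟩
            c⁻¹ * (cs zero * v j)                ≈⟨ *-congˡ (+-inverseˡ-unique _ _ (comb≈0 j)) ⟩
            c⁻¹ * - lincomb d (tail cs) x j      ≈⟨ sym (-‿distribʳ-* _ _) ⟩
            - (c⁻¹ * lincomb d (tail cs) x j)    ≈⟨ -‿distribˡ-* _ _ ⟩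
            - c⁻¹ * lincomb d (tail cs) x j      ≈⟨ sym (lincomb-* d (- c⁻¹) (tail cs) x j) ⟩
            lincomb d (λ i → - c⁻¹ * cs (suc i)) x j ∎

        head∉span-tail : ∀ {d} {x : Fin (suc d) → V k} → Independent P (suc d) x → ¬ Span P d (tail x) (head x)
        head∉span-tail {d} {x} x-indep (cs , cs∈P , x₀≈) =
          proj₁ isField (-‿injective (trans -1≈0 (sym -0#≈0#)))
          where
          comb≈0 : lincomb (suc d) (- 1# ∷ cs) x ≈ᵥ 0ᵥ
          comb≈0 j = begin
            - 1# * x zero j + lincomb d cs (tail x) j ≈⟨ +-cong (-1*x≈-x _) (sym (x₀≈ j)) ⟩
            - x zero j + x zero j                     ≈⟨ -‿inverseˡ _ ⟩
            0#                                        ∎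
          -1≈0 : - 1# ≈ 0#
          -1≈0 = x-indep (- 1# ∷ cs) (∷⁺ {P = P} (P-neg P-1) cs∈P) comb≈0 zero

        span-eliminate-head : ∀ {p} (y : Fin (suc p) → V k) (D E : Fin (suc p) → F) →
                              (∀ l → P (D l)) → (∀ l → P (E l)) → ¬ E zero ≈ 0# →
                              Σ F λ s → P s × Span P p (tail y) (lincomb (suc p) D y +ᵥ (s · lincomb (suc p) E y))
        span-eliminate-head {p} y D E D∈P E∈P E₀≉0 with P-inv (E∈P zero) E₀≉0
        ... | e⁻¹ , e⁻¹∈P , E₀e⁻¹≈1 =
          s , s∈P , tail D+sE , (λ l → P-+ (D∈P (suc l)) (P-* s∈P (E∈P (suc l)))) , λ j → begin
            lincomb (suc p) D y j + s * lincomb (suc p) E y j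
              ≈⟨ +-congˡ (sym (lincomb-* (suc p) s E y j)) ⟩
            lincomb (suc p) D y j + lincomb (suc p) (λ l → s * E l) y j
              ≈⟨ sym (lincomb-+ (suc p) D (λ l → s * E l) y j) ⟩
            lincomb (suc p) D+sE y j
              ≈⟨ lincomb-head-zero p D+sE y D+sE₀≈0 j ⟩
            lincomb p (tail D+sE) (tail y) j ∎
          where
          s : F
          s = - (D zero * e⁻¹)
          s∈P : P s
          s∈P = P-neg (P-* (D∈P zero) e⁻¹∈P)
          D+sE : Fin (suc p) → F
          D+sE l = D l + s * E l
          D+sE₀≈0 : D+sE zero ≈ 0#
          D+sE₀≈0 = begin
            D zero + - (D zero * e⁻¹) * E zero   ≈⟨ +-congˡ (sym (-‿distribˡ-* _ _)) ⟩
            D zero + - (D zero * e⁻¹ * E zero)   ≈⟨ +-congˡ (-‿cong (*-assoc _ _ _)) ⟩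
            D zero + - (D zero * (e⁻¹ * E zero)) ≈⟨ +-congˡ (-‿cong (*-congˡ (trans (*-comm _ _) E₀e⁻¹≈1))) ⟩
            D zero + - (D zero * 1#)             ≈⟨ +-congˡ (-‿cong (*-identityʳ _)) ⟩
            D zero + - D zero                    ≈⟨ -‿inverseʳ _ ⟩
            0#                                   ∎

        independent-shear : ∀ {a} {x : Fin (suc a) → V k} → Independent P (suc a) x →
                            ∀ i (s : Fin a → F) → (∀ j → P (s j)) →
                            Independent P a (λ j → removeAt x i j +ᵥ (s j · x i))
        independent-shear {a} {x} x-indep i s s∈P es es∈P comb≈0 j =
          trans (reflexive (≡.sym (insertAt-punchIn es i σ j))) (x-indep (insertAt es i σ) coeffs∈P lifted (punchIn i j))
          where
          σ : F
          σ = sum (λ l → es l * s l)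
          coeffs∈P : ∀ l → P (insertAt es i σ l)
          coeffs∈P = insertAt⁺ {P = P} es i (sum-closed _ (λ l → P-* (es∈P l) (s∈P l))) es∈P
          lifted : lincomb (suc a) (insertAt es i σ) x ≈ᵥ 0ᵥ
          lifted m = begin
            lincomb (suc a) (insertAt es i σ) x m
              ≈⟨ lincomb-insertAt a es i σ x m ⟩
            σ * x i m + lincomb a es (removeAt x i) m
              ≈⟨ +-comm _ _ ⟩
            lincomb a es (removeAt x i) m + σ * x i m
              ≈⟨ +-congˡ (sym (lincomb-· a es s (x i) m)) ⟩
            lincomb a es (removeAt x i) m + lincomb a es (λ l → s l · x i) m
              ≈⟨ sym (lincomb-+ᵥ a es _ _ m) ⟩
            lincomb a es (λ l → removeAt x i l +ᵥ (s l · x i)) m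
              ≈⟨ comb≈0 m ⟩
            0# ∎

        -- Induction on p: if no x i involves y zero, drop y zero; otherwise pivot on an x i that
        -- does and eliminate y zero from the others.
        steinitz : ∀ p a (y : Fin p → V k) (x : Fin a → V k) →
                   Independent P a x → (∀ i → Span P p y (x i)) → a ≤ p
        steinitz p       zero    y x _       _  = z≤n
        steinitz zero    (suc a) y x x-indep x∈ =
          ⊥-elim (head∉span-tail {x = x} x-indep
                    (span-resp {P = P} (≋-sym (proj₂ (proj₂ (x∈ zero)))) (span-0 {x = tail x})))
        steinitz (suc p) (suc a) y x x-indep x∈ = by-pivot (any? λ i → ¬? (coeff i zero ≟ 0#))
          where
          coeff : Fin (suc a) → Fin (suc p) → F
          coeff i = proj₁ (x∈ i)
          coeff∈P : ∀ i l → P (coeff i l)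
          coeff∈P i = proj₁ (proj₂ (x∈ i))
          x≈ : ∀ i → x i ≈ᵥ lincomb (suc p) (coeff i) y
          x≈ i = proj₂ (proj₂ (x∈ i))
          by-pivot : Dec (∃ λ i → ¬ coeff i zero ≈ 0#) → suc a ≤ suc p
          by-pivot (no no-pivot) = m≤n⇒m≤1+n (steinitz p (suc a) (tail y) x x-indep x∈tail)
            where
            x∈tail : ∀ i → Span P p (tail y) (x i)
            x∈tail i = tail (coeff i) , coeff∈P i ∘ suc , ≋-trans (x≈ i) (lincomb-head-zero p (coeff i) y
              (decidable-stable (coeff i zero ≟ 0#) λ c≉0 → no-pivot (i , c≉0)))
          by-pivot (yes (i , pivot≉0)) = s≤s (steinitz p a (tail y) x′ (independent-shear {x = x} x-indep i s s∈P) x′∈)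
            where
            eliminate : ∀ j → Σ F λ s → P s × Span P p (tail y)
                          (lincomb (suc p) (coeff (punchIn i j)) y +ᵥ (s · lincomb (suc p) (coeff i) y))
            eliminate j = span-eliminate-head y (coeff (punchIn i j)) (coeff i) (coeff∈P _) (coeff∈P i) pivot≉0
            s : Fin a → F
            s j = proj₁ (eliminate j)
            s∈P : ∀ j → P (s j)
            s∈P j = proj₁ (proj₂ (eliminate j))
            x′ : Fin a → V k
            x′ j = removeAt x i j +ᵥ (s j · x i)
            x′∈ : ∀ j → Span P p (tail y) (x′ j)
            x′∈ j = span-resp {P = P} (λ m → +-cong (sym (x≈ (punchIn i j) m)) (*-congˡ (sym (x≈ i m))))
                                      (proj₂ (proj₂ (eliminate j)))

        maximal⇒spanning : ∀ {M} → HasSize P M → ∀ {d} {x : Fin d → V k} {S : Subset {k}} → Independent P d x →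
                           (∀ v → S v → ¬ Independent P (suc d) (v ∷ x)) → ∀ v → S v → Span P d x v
        maximal⇒spanning P-finite x-indep maximal v v∈S =
          decidable-stable (span? P-finite _ _ v) (λ v∉ → maximal v v∈S (independent-∷ x-indep v∉))

    open Exchange All-subfield

    module _ {k : ℕ} where

      spanning-family : ∀ {P U d} {x : Fin d → V k} → SpansAll U → (∀ v → U v → Span P d x v) →
                        ∀ v → Span All d x v
      spanning-family {P} U-spans x-spans v with U-spans v
      ... | _ , us , cs , us∈U , v≈ =
        span-trans (λ i → span-weaken {P = P} (x-spans (us i) (us∈U i))) (cs , (λ _ → lift _) , v≈)

      unit-independent : Independent All k unit
      unit-independent cs _ comb≈0 i = trans (sym (lincomb-unit k cs i)) (comb≈0 i)

      independent⇒≤dim : ∀ {d} {x : Fin d → V k} → Independent All d x → d ≤ k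
      independent⇒≤dim {d} {x} x-indep =
        steinitz k d unit x x-indep (λ i → x i , (λ _ → lift _) , ≋-sym (lincomb-unit k (x i)))

      spanning⇒dim≤ : ∀ {d} {x : Fin d → V k} → (∀ v → Span All d x v) → k ≤ d
      spanning⇒dim≤ {d} {x} x-spans = steinitz d k x unit unit-independent (x-spans ∘ unit)

      basis-size : ∀ {d} {x : Fin d → V k} → Independent All d x → (∀ v → Span All d x v) → d ≡ k
      basis-size x-indep x-spans = ≤-antisym (independent⇒≤dim x-indep) (spanning⇒dim≤ x-spans)

      independent-++ : ∀ {P : Scalars} {a t w} {x : Fin a → V k} {y : Fin t → V k} {b : Fin w → V k} →
                       Independent All (a ℕ.+ t) (x ++ y) → Independent P w b → (∀ j → Span All t y (b j)) →
                       Independent P (a ℕ.+ w) (x ++ b)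
      independent-++ {P} {a} {t} {w} {x} {y} {b} xy-indep b-indep b∈ cs cs∈P comb≈0 i =
        trans (reflexive (≡.sym (take-++-drop a cs i))) (++⁺ (_≈ 0#) cs₁≈0 cs₂≈0 i)
        where
        cs₁ : Fin a → F
        cs₁ = take a cs
        cs₂ : Fin w → F
        cs₂ = drop a cs
        split≈0 : (lincomb a cs₁ x +ᵥ lincomb w cs₂ b) ≈ᵥ 0ᵥ
        split≈0 = ≋-trans (≋-sym (lincomb-++ a cs₁ cs₂ x b))
                    (≋-trans (lincomb-cong (a ℕ.+ w) (reflexive ∘ take-++-drop a cs) (λ _ → ≋-refl)) comb≈0)
        b-part∈ : Span All t y (lincomb w cs₂ b)
        b-part∈ = lincomb-closed span-isSubspace w (λ _ → lift _) b∈
        E : Fin t → F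
        E = proj₁ b-part∈
        cs₁≈0 : ∀ i → cs₁ i ≈ 0#
        cs₁≈0 = ++⁻ˡ (_≈ 0#) cs₁ (xy-indep (cs₁ ++ E) (λ _ → lift _) (λ j → begin
          lincomb (a ℕ.+ t) (cs₁ ++ E) (x ++ y) j  ≈⟨ lincomb-++ a cs₁ E x y j ⟩
          lincomb a cs₁ x j + lincomb t E y j      ≈⟨ +-congˡ (sym (proj₂ (proj₂ b-part∈) j)) ⟩
          lincomb a cs₁ x j + lincomb w cs₂ b j    ≈⟨ split≈0 j ⟩
          0#                                       ∎))
        cs₂≈0 : ∀ j → cs₂ j ≈ 0#
        cs₂≈0 = b-indep cs₂ (cs∈P ∘ (a Fin.↑ʳ_)) (λ j → begin
          lincomb w cs₂ b j                        ≈⟨ sym (+-identityˡ _) ⟩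
          0# + lincomb w cs₂ b j                   ≈⟨ +-congʳ (sym (lincomb-zeroˡ a x cs₁≈0 j)) ⟩
          lincomb a cs₁ x j + lincomb w cs₂ b j    ≈⟨ split≈0 j ⟩
          0#                                       ∎)

      extend-by : (Q : Subset {k}) {t : ℕ} (τ : Fin t → V k) → Independent All t τ →
                  ∀ {s} (u : Fin s → V k) → (∀ i → Q (u i)) →
                  Σ ℕ λ r → Σ (Fin r → V k) λ z → (∀ j → Q (z j)) × Independent All (r ℕ.+ t) (z ++ τ)
                    × (∀ i → Span All (r ℕ.+ t) (z ++ τ) (u i))
      extend-by Q τ τ-indep {zero} u u∈Q = 0 , (λ ()) , (λ ()) , τ-indep , (λ ())
      extend-by Q {t} τ τ-indep {suc s} u u∈Q with extend-by Q τ τ-indep (tail u) (u∈Q ∘ suc)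
      ... | r , z , z∈Q , zτ-indep , tail-u∈ with span? L-finite (r ℕ.+ t) (z ++ τ) (head u)
      ...   | yes u₀∈ = r , z , z∈Q , zτ-indep , λ where
        zero    → u₀∈
        (suc i) → tail-u∈ i
      ...   | no u₀∉ = suc r , head u ∷ z , ∷⁺ {P = Q} (u∈Q zero) z∈Q ,
        independent-resp-≗ {P = All} reassociate (independent-∷ zτ-indep u₀∉) , λ where
          zero    → span-resp-≗ {P = All} reassociate (span-member (head u ∷ (z ++ τ)) zero)
          (suc i) → span-resp-≗ {P = All} reassociate (span-∷ (head u) (tail-u∈ i))
        where
        reassociate : head u ∷ (z ++ τ) ≗ (head u ∷ z) ++ τ
        reassociate = ≡.sym ∘ ∷-++ (head u) z τ

      extend-to-basis : (Q : Subset {k}) {s : ℕ} (u : Fin s → V k) → (∀ i → Q (u i)) → (∀ v → Span All s u v) →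
                        ∀ {t} (τ : Fin t → V k) → Independent All t τ →
                        Σ ℕ λ r → Σ (Fin r → V k) λ z → (∀ j → Q (z j)) × Independent All (r ℕ.+ t) (z ++ τ)
                          × (r ℕ.+ t ≡ k)
      extend-to-basis Q u u∈Q u-spans τ τ-indep with extend-by Q τ τ-indep u u∈Q
      ... | r , z , z∈Q , zτ-indep , u∈span =
        r , z , z∈Q , zτ-indep , basis-size zτ-indep (span-trans u∈span ∘ u-spans)

      module Hyperplane {K : Scalars} (K-subfield : IsSubfield K) {M} (K-finite : HasSize K M)
        {n} {U : Subset {k}} (u : Fin n → V k) (u-span : ∀ v → U v → Span K n u v)
        {r t w} (z : Fin (suc r) → V k) (τ : Fin t → V k) (b : Fin w → V k)
        (z∈U : ∀ j → U (z j)) (zτ-indep : Independent All (suc r ℕ.+ t) (z ++ τ))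
        (b∈U : ∀ j → U (b j)) (b∈T : ∀ j → Span All t τ (b j)) (b-indep : Independent K w b)
        (n≡r+w : n ≡ suc r ℕ.+ w)
        where

        module 𝕂 = Exchange K-subfield

        H : Subset {k}
        H = Span All (r ℕ.+ t) (tail z ++ τ)

        H-dim : HasDim All H (r ℕ.+ t)
        H-dim = tail z ++ τ , span-member _ ,
                independent-resp-≗ {P = All} (++-tail z τ) (independent-tail {x = z ++ τ} zτ-indep) ,
                λ _ v∈H → v∈H

        z₀∉H : ¬ H (head z)
        z₀∉H = head∉span-tail {x = z ++ τ} zτ-indep ∘ span-resp-≗ {P = All} (≡.sym ∘ ++-tail z τ)

        G : Fin (r ℕ.+ w) → V k
        G = tail z ++ b

        G⊆U∩H : ∀ i → (U ∩ H) (G i)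
        G⊆U∩H = ++⁺ (U ∩ H) (λ j → z∈U (suc j) , ≡.subst H (lookup-++ˡ (tail z) τ j) (span-member _ _))
                            (λ j → b∈U j , span-trans τ⊆H (b∈T j))
          where
          τ⊆H : ∀ j → H (τ j)
          τ⊆H j = ≡.subst H (lookup-++ʳ (tail z) τ j) (span-member _ _)

        G-maximal : ∀ v → (U ∩ H) v → ¬ Independent K (suc (r ℕ.+ w)) (v ∷ G)
        G-maximal v (v∈U , v∈H) vG-indep = 1+n≰n (≡.subst (suc (suc (r ℕ.+ w)) ≤_) n≡r+w too-many)
          where
          z₀∉span : ¬ Span K (suc (r ℕ.+ w)) (v ∷ G) (head z)
          z₀∉span = z₀∉H ∘ span-trans {x = v ∷ G} (∷⁺ {P = H} v∈H (proj₂ ∘ G⊆U∩H))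
                         ∘ span-weaken {P = K} {x = v ∷ G}
          too-many : suc (suc (r ℕ.+ w)) ≤ n
          too-many = 𝕂.steinitz n _ u (head z ∷ (v ∷ G)) (𝕂.independent-∷ {x = v ∷ G} vG-indep z₀∉span)
                       (λ i → u-span _ (∷⁺ {P = U} (z∈U zero) (∷⁺ {P = U} v∈U (proj₁ ∘ G⊆U∩H)) i))

        U∩H-dim : HasDim K (U ∩ H) (r ℕ.+ w)
        U∩H-dim = G , G⊆U∩H , G-indep , 𝕂.maximal⇒spanning K-finite G-indep G-maximal
          where
          G-indep : Independent K (r ℕ.+ w) G
          G-indep = independent-++ {P = K} {x = tail z} (proj₁ (proj₂ (proj₂ H-dim))) b-indep b∈T

      maxDefect⇒hyperplane : ∀ {K : Scalars} → IsSubfield K → ∀ {M} → HasSize K M →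
        ∀ {U : Subset {k}} {n} → HasDim K U n → SpansAll U → ∀ {T t} → HasMaxDefect K U n T t → t < k →
        Σ (Subset {k}) (IsHyperplaneOfWeight K U (n ∸ 1))
      maxDefect⇒hyperplane {K} K-subfield K-finite {U} {n} (u , u∈U , _ , u-span) U-spans
        (_ , (τ , _ , τ-indep , τ-span) , w , (b , b∈U∩T , b-indep , _) , w+k≡n+t) t<k
        with extend-to-basis U u u∈U (spanning-family {P = K} U-spans u-span) τ τ-indep
      ... | zero , _ , _ , _ , t≡k = ⊥-elim (<⇒≢ t<k t≡k)
      ... | suc r , z , z∈U , zτ-indep , r+t≡k =
        H , span-isSubspace ,
        ≡.subst (HasDim All H) (≡.cong (_∸ 1) r+t≡k) H-dim ,
        ≡.subst (HasDim K (U ∩ H)) (≡.cong (_∸ 1) (≡.sym n≡r+w)) U∩H-dim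
        where
        n≡r+w : n ≡ suc r ℕ.+ w
        n≡r+w = count-cancel (suc r) w+k≡n+t r+t≡k
        open Hyperplane K-subfield K-finite u u-span z τ b z∈U zτ-indep (proj₁ ∘ b∈U∩T)
                        (λ j → τ-span (b j) (proj₂ (b∈U∩T j))) b-indep n≡r+w

      hyperplane⇒t<k : ∀ {K : Scalars} {U : Subset {k}} {n t} → 1 ≤ k → k ≤ n →
        (∀ T t′ → HasMaxDefect K U n T t′ → t ≤ t′) →
        Σ (Subset {k}) (IsHyperplaneOfWeight K U (n ∸ 1)) → t < k
      hyperplane⇒t<k {n = n} 1≤k@(s≤s z≤n) k≤n minimal (H , H-subspace , H-dim , U∩H-dim) =
        s≤s (minimal H _ (H-subspace , H-dim , n ∸ 1 , U∩H-dim , pred-+-suc (≤-trans 1≤k k≤n)))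

theorem1p10 : {c ℓ : Level} (L : CommutativeRing c ℓ) → let open FieldTheory L in
    (q m k n : ℕ) → IsPrimePower q → 1 ≤ k → 1 ≤ m →
    IsField → HasSize All (q ^ m) →
    (K : CommutativeRing.Carrier L → Set _) → IsSubfield K → HasSize K q →
    (U : Subset {k}) → IsSubspace K U → HasDim K U n → SpansAll U →
    (t : ℕ) → IsTs K U n t →
    (t < k) ⇔ (Σ (Subset {k}) λ H → IsSubspace All H × HasDim All H (k ∸ 1) × HasDim K (U ∩ H) (n ∸ 1))
theorem1p10 L q m k n _ 1≤k _ isField L-finite K K-subfield K-finite U _ U-dim@(u , _ , _ , u-span) U-spans t
  ((_ , T-maxDefect) , t-minimal) =
  mk⇔ (maxDefect⇒hyperplane K-subfield K-finite U-dim U-spans T-maxDefect)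
      (hyperplane⇒t<k {K = K} 1≤k (spanning⇒dim≤ {x = u} (spanning-family {P = K} U-spans u-span)) t-minimal)
  where
  open LinearAlgebra L
  open FiniteField isField L-finite
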